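{- For all $k\ge1$, all $a\in\mathbb{C}$ and all $n\ge1$, $$A^{(k)}_n(a)=a^nA^{(k)}_n(1).$$
   Context: The complete exponential Bell polynomials $B_n$ are defined by $\exp\left(\sum_{m\ge1}y_mt^m/m!\right)=\sum_{n\ge0}B_n(y_1,\dots,y_n)t^n/n!$. For $\mathbf{x}=(x_1,\dots,x_k)\in\mathbb{C}^k$ the complete exponential autonomous functions of order $k$ are defined by $f_j(\mathbf{x},a)=x_{j+1}$ for $0\le j\le k-1$, $f_k(\mathbf{x},a)=ae^{x_1}$, and $f_{n+k}(\mathbf{x},a)=ae^{x_1}B_n(f_1(\mathbf{x},a),\dots,f_n(\mathbf{x},a))$ for $n\ge1$. The numbers $A^{(k)}_n(a)$ are defined by $f_{kn}((x_1,0,\dots,0),a)=A^{(k)}_n(a)e^{nx_1}$ for $n\ge1$ (this quantity has this form and $A^{(k)}_n(a)$ does not depend on $x_1$); equivalently $A^{(k)}_1(a)=a$ and $A^{(k)}_{n+2}(a)=\sum_{i=0}^{n}\binom{kn+k-1}{ki+k-1}A^{(k)}_{n-i+1}(a)A^{(k)}_{i+1}(a)$ for $n\ge0$. -}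

module Defs where

open import Level using (Level)
open import Algebra.Bundles using (CommutativeRing)
open import Data.Nat using (ℕ; zero; suc; _∸_) renaming (_+_ to _+ℕ_; _*_ to _*ℕ_)
open import Data.Nat.Combinatorics using (_C_)
open import Data.Fin using (Fin; toℕ; opposite)
import Data.Fin as Fin
open import Data.Vec using (Vec; []; _∷_; lookup; head)

module CompleteExpAutonomous {c ℓ : Level} (R : CommutativeRing c ℓ) where
  open CommutativeRing R

  ℕ→R : ℕ → Carrier
  ℕ→R zero    = 0#
  ℕ→R (suc n) = 1# + ℕ→R n

  pow : Carrier → ℕ → Carrier
  pow x zero    = 1#
  pow x (suc n) = x * pow x n

  sumFin : (m : ℕ) → (Fin m → Carrier) → Carrier
  sumFin zero    f = 0#
  sumFin (suc m) f = f Fin.zero + sumFin m (λ i → f (Fin.suc i))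

  -- Given prev = [A_{n+1}, ..., A_1], the next value
  -- A_{n+2} = Σ_{i=0}^{n} C(kn+k-1, ki+k-1) A_{n-i+1} A_{i+1}
  next : ℕ → (n : ℕ) → Vec Carrier (suc n) → Carrier
  next k n prev = sumFin (suc n) (λ i →
            ℕ→R ((k *ℕ n +ℕ k ∸ 1) C (k *ℕ toℕ i +ℕ k ∸ 1))
              * (lookup prev i * lookup prev (opposite i)))

  -- table k a m = [A_m, A_{m-1}, ..., A_1]  (reversed list of the first m values),
  -- so that lookup at index j is A_{m-j}.
  table : ℕ → Carrier → (m : ℕ) → Vec Carrier m
  table k a zero          = []
  table k a (suc zero)    = a ∷ []
  table k a (suc (suc n)) = next k n (table k a (suc n)) ∷ table k a (suc n)

  -- A k a n = A^{(k)}_n(a) for n ≥ 1  (A k a 0 = 0 is an unused junk value)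
  A : ℕ → Carrier → ℕ → Carrier
  A k a zero    = 0#
  A k a (suc n) = head (table k a (suc n))

module Submission where

-- A^{(k)}_n(a) is homogeneous of degree n in a: the recursion builds A_{n+2} from products
-- A_{n-i+1} A_{i+1}, whose degrees add up to n + 2, with binomial coefficients independent
-- of a.  Inducting along the table of values, each entry A_m(a) is a^m A_m(1).

open import Defs
open import Level using (Level)
open import Algebra.Bundles using (CommutativeRing)
import Algebra.Properties.CommutativeSemigroup as CommutativeSemigroupProperties
open import Data.Nat using (ℕ; _≤_; zero; suc; _∸_) renaming (_+_ to _+ℕ_; _*_ to _*ℕ_)
open import Data.Nat.Combinatorics using (_C_)
open import Data.Nat.Properties using (+-∸-assoc; m∸n≤m; m∸[m∸n]≡n; +-suc; m∸n+n≡m)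
open import Data.Fin using (Fin; toℕ; opposite)
import Data.Fin as Fin
open import Data.Fin.Properties using (opposite-prop; toℕ≤pred[n])
open import Data.Vec using (Vec; lookup)
open import Relation.Binary.PropositionalEquality as ≡ using (_≡_)
import Relation.Binary.Reasoning.Setoid as SetoidReasoning

[1+n∸i]+[1+n∸[n∸i]]≡2+n : ∀ {i n} → i ≤ n → (suc n ∸ i) +ℕ (suc n ∸ (n ∸ i)) ≡ suc (suc n)
[1+n∸i]+[1+n∸[n∸i]]≡2+n {i} {n} i≤n = begin
  (suc n ∸ i) +ℕ (suc n ∸ (n ∸ i))  ≡⟨ ≡.cong₂ _+ℕ_ (+-∸-assoc 1 i≤n) (+-∸-assoc 1 (m∸n≤m n i)) ⟩
  suc (n ∸ i) +ℕ suc (n ∸ (n ∸ i))  ≡⟨ ≡.cong (λ j → suc (n ∸ i) +ℕ suc j) (m∸[m∸n]≡n i≤n) ⟩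
  suc (n ∸ i +ℕ suc i)              ≡⟨ ≡.cong suc (+-suc (n ∸ i) i) ⟩
  suc (suc (n ∸ i +ℕ i))            ≡⟨ ≡.cong (λ j → suc (suc j)) (m∸n+n≡m i≤n) ⟩
  suc (suc n)                       ∎
  where open ≡.≡-Reasoning

module Homogeneity {c ℓ : Level} (R : CommutativeRing c ℓ) where
  open CommutativeRing R
  open CompleteExpAutonomous R
  open CommutativeSemigroupProperties *-commutativeSemigroup using (interchange; x∙yz≈y∙xz)
  open SetoidReasoning setoid

  pow-+ : ∀ x m n → pow x (m +ℕ n) ≈ pow x m * pow x n
  pow-+ x zero    n = sym (*-identityˡ _)
  pow-+ x (suc m) n = trans (*-congˡ (pow-+ x m n)) (sym (*-assoc _ _ _))

  sumFin-cong : ∀ m {f g : Fin m → Carrier} → (∀ i → f i ≈ g i) → sumFin m f ≈ sumFin m g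
  sumFin-cong zero    f≈g = refl
  sumFin-cong (suc m) f≈g = +-cong (f≈g Fin.zero) (sumFin-cong m (λ i → f≈g (Fin.suc i)))

  *-distribˡ-sumFin : ∀ m p (f : Fin m → Carrier) → p * sumFin m f ≈ sumFin m (λ i → p * f i)
  *-distribˡ-sumFin zero    p f = zeroʳ p
  *-distribˡ-sumFin (suc m) p f =
    trans (distribˡ p _ _) (+-congˡ (*-distribˡ-sumFin m p (λ i → f (Fin.suc i))))

  -- Entry j of a table of length m is A_{m-j}, of degree m - j in a.
  Rescaled : ∀ {m} → Carrier → Vec Carrier m → Vec Carrier m → Set ℓ
  Rescaled {m} a u v = ∀ j → lookup u j ≈ pow a (m ∸ toℕ j) * lookup v j

  next-rescaled : ∀ k n a (u v : Vec Carrier (suc n)) → Rescaled a u v →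
                  next k n u ≈ pow a (suc (suc n)) * next k n v
  next-rescaled k n a u v u≈a·v = begin
    next k n u
      ≈⟨ sumFin-cong (suc n) term-rescaled ⟩
    sumFin (suc n) (λ i → pow a (suc (suc n)) * term v i)
      ≈⟨ *-distribˡ-sumFin (suc n) _ (term v) ⟨
    pow a (suc (suc n)) * next k n v ∎
    where
    binomial : Fin (suc n) → Carrier
    binomial i = ℕ→R ((k *ℕ n +ℕ k ∸ 1) C (k *ℕ toℕ i +ℕ k ∸ 1))

    term : Vec Carrier (suc n) → Fin (suc n) → Carrier
    term w i = binomial i * (lookup w i * lookup w (opposite i))

    degrees : ∀ i → (suc n ∸ toℕ i) +ℕ (suc n ∸ toℕ (opposite i)) ≡ suc (suc n)
    degrees i rewrite opposite-prop i = [1+n∸i]+[1+n∸[n∸i]]≡2+n (toℕ≤pred[n] i)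

    term-rescaled : ∀ i → term u i ≈ pow a (suc (suc n)) * term v i
    term-rescaled i = begin
      binomial i * (lookup u i * lookup u (opposite i))
        ≈⟨ *-congˡ (*-cong (u≈a·v i) (u≈a·v (opposite i))) ⟩
      binomial i * ((pow a d₁ * lookup v i) * (pow a d₂ * lookup v (opposite i)))
        ≈⟨ *-congˡ (interchange _ _ _ _) ⟩
      binomial i * ((pow a d₁ * pow a d₂) * (lookup v i * lookup v (opposite i)))
        ≈⟨ x∙yz≈y∙xz _ _ _ ⟩
      (pow a d₁ * pow a d₂) * term v i
        ≈⟨ *-congʳ (pow-+ a d₁ d₂) ⟨
      pow a (d₁ +ℕ d₂) * term v i
        ≡⟨ ≡.cong (λ d → pow a d * term v i) (degrees i) ⟩
      pow a (suc (suc n)) * term v i ∎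
      where
      d₁ = suc n ∸ toℕ i
      d₂ = suc n ∸ toℕ (opposite i)

  table-rescaled : ∀ k a m → Rescaled a (table k a m) (table k 1# m)
  table-rescaled k a (suc zero)    Fin.zero    = sym (trans (*-identityʳ _) (*-identityʳ a))
  table-rescaled k a (suc (suc n)) Fin.zero    =
    next-rescaled k n a (table k a (suc n)) (table k 1# (suc n)) (table-rescaled k a (suc n))
  table-rescaled k a (suc (suc n)) (Fin.suc j) = table-rescaled k a (suc n) j

  A-homogeneous : ∀ k a n → A k a n ≈ pow a n * A k 1# n
  A-homogeneous k a zero          = sym (*-identityˡ 0#)
  A-homogeneous k a (suc zero)    = table-rescaled k a 1 Fin.zero
  A-homogeneous k a (suc (suc n)) = table-rescaled k a (suc (suc n)) Fin.zero

mainTheorem4 : ∀ {c ℓ : Level} (R : CommutativeRing c ℓ) →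
    let open CommutativeRing R
        open CompleteExpAutonomous R
    in (k : ℕ) → 1 ≤ k → (a : Carrier) → (n : ℕ) → 1 ≤ n →
    A k a n ≈ pow a n * A k 1# n
mainTheorem4 R k _ a n _ = Homogeneity.A-homogeneous R k a n
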